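{- Let $D$ be a principal ideal domain containing a unit $\varepsilon$ such that $\eta=\varepsilon-\varepsilon^{ -1}$ is also a unit. Let $Z\in\operatorname{SL}_2(D)$ and suppose there exists $U\in\mathfrak S(Z)$ with $\operatorname{Tr}U=\varepsilon+\varepsilon^{ -1}$. Then $Z$ is a commutator in $\operatorname{SL}_2(D)$, i.e. $Z=XYX^{ -1}Y^{ -1}$ for some $X,Y\in\operatorname{SL}_2(D)$.
   Context: For a $2\times2$ matrix $A$ over $D$, $\mathfrak S(A)=\{X\in M_2(D):\operatorname{Tr}(AX)=\operatorname{Tr}X,\ \det X=1\}$. -}

module Defs where

open import Level using (Level; _⊔_; suc)
open import Algebra.Bundles using (CommutativeRing)
open import Data.Product using (Σ; ∃; _×_; _,_)
open import Data.Sum using (_⊎_)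
open import Relation.Nullary using (¬_)

module _ {c ℓ : Level} (R : CommutativeRing c ℓ) where
  open CommutativeRing R

  IsInverse : Carrier → Carrier → Set ℓ
  IsInverse x y = x * y ≈ 1#

  IsIntegralDomain : Set (c ⊔ ℓ)
  IsIntegralDomain = (¬ (1# ≈ 0#)) × (∀ a b → a * b ≈ 0# → (a ≈ 0#) ⊎ (b ≈ 0#))

  record IsIdeal {p : Level} (I : Carrier → Set p) : Set (c ⊔ ℓ ⊔ p) where
    field
      resp  : ∀ {x y} → x ≈ y → I x → I y
      zero∈ : I 0#
      +∈    : ∀ {x y} → I x → I y → I (x + y)
      -∈    : ∀ {x} → I x → I (- x)
      *∈    : ∀ r {x} → I x → I (r * x)

  IsPrincipal : {p : Level} → (Carrier → Set p) → Set (c ⊔ ℓ ⊔ p)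
  IsPrincipal I = Σ Carrier λ a → ∀ x → (I x → Σ Carrier λ r → x ≈ r * a) × ((Σ Carrier λ r → x ≈ r * a) → I x)

  IsPID : Set (suc (c ⊔ ℓ))
  IsPID = IsIntegralDomain × (∀ (I : Carrier → Set (c ⊔ ℓ)) → IsIdeal I → IsPrincipal I)

  record M₂ : Set c where
    constructor mat
    field
      a₁₁ a₁₂ a₂₁ a₂₂ : Carrier

  open M₂ public

  _·_ : M₂ → M₂ → M₂
  A · B = mat (a₁₁ A * a₁₁ B + a₁₂ A * a₂₁ B) (a₁₁ A * a₁₂ B + a₁₂ A * a₂₂ B)
              (a₂₁ A * a₁₁ B + a₂₂ A * a₂₁ B) (a₂₁ A * a₁₂ B + a₂₂ A * a₂₂ B)

  Tr : M₂ → Carrier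
  Tr A = a₁₁ A + a₂₂ A

  det : M₂ → Carrier
  det A = a₁₁ A * a₂₂ A - a₁₂ A * a₂₁ A

  adj : M₂ → M₂
  adj A = mat (a₂₂ A) (- a₁₂ A) (- a₂₁ A) (a₁₁ A)

  _≈M_ : M₂ → M₂ → Set ℓ
  A ≈M B = (a₁₁ A ≈ a₁₁ B) × (a₁₂ A ≈ a₁₂ B) × (a₂₁ A ≈ a₂₁ B) × (a₂₂ A ≈ a₂₂ B)

  InSL₂ : M₂ → Set ℓ
  InSL₂ X = det X ≈ 1#

  𝔖 : M₂ → M₂ → Set ℓ
  𝔖 A X = (Tr (A · X) ≈ Tr X) × (det X ≈ 1#)

  -- Z is a commutator in SL₂(D): Z = X Y X⁻¹ Y⁻¹, with X⁻¹ = adj X since det X = 1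
  IsCommutatorSL₂ : M₂ → Set (c ⊔ ℓ)
  IsCommutatorSL₂ Z = Σ M₂ λ X → Σ M₂ λ Y →
    InSL₂ X × InSL₂ Y × (Z ≈M (((X · Y) · adj X) · adj Y))

-- Every A ∈ SL₂(D) of trace ε + ε⁻¹ is conjugate in SL₂(D) to diag(ε, ε⁻¹). Indeed
-- det(A − ε⁻¹I) = 1 − ε⁻¹(ε + ε⁻¹) + ε⁻² = 0, and over a PID a singular 2×2 matrix is an
-- outer product v wᵀ: with g = gcd(a, c) = ra + sc, a = αg and c = βg, take v = (α, β) and
-- w = (g, rb + sd). Then v is an ε-eigenvector of A = v wᵀ + ε⁻¹I, every vector orthogonal
-- to w is an ε⁻¹-eigenvector, and scaling the latter by (ε − ε⁻¹)⁻¹ makes the eigenbasis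
-- unimodular. Both U and ZU lie in SL₂(D) and have trace ε + ε⁻¹ (the latter because
-- U ∈ 𝔖(Z)), so XUX⁻¹ = ZU for some X ∈ SL₂(D), that is Z = XUX⁻¹U⁻¹.

module Submission where

open import Defs
open import Level using (Level; _⊔_)
open import Algebra.Bundles using (CommutativeRing; Group)
open import Algebra.Solver.Ring.AlmostCommutativeRing
  using (fromCommutativeRing; _-Raw-AlmostCommutative⟶_)
open import Data.Integer as ℤ using (ℤ; +_; -[1+_]; _⊖_)
import Data.Integer.Properties as ℤ
open import Data.Maybe using (Maybe; just; nothing)
open import Data.Nat as ℕ using (zero; suc)
import Data.Nat.Properties as ℕ
open import Data.Product using (Σ; _×_; _,_; proj₁; proj₂)
open import Data.Sign as Sign using (Sign)
open import Data.Sum using (_⊎_; inj₁; inj₂; map₂)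
open import Function using (_$_)
import Relation.Binary.PropositionalEquality as ≡
open import Relation.Nullary using (yes; no)

-- The ring solver needs a coefficient ring mapped into R; ℤ, through its canonical
-- homomorphism, serves every commutative ring.
module IntegerCoefficients {c ℓ : Level} (R : CommutativeRing c ℓ) where
  open CommutativeRing R
  open import Algebra.Properties.Ring ring using (-1*x≈-x; -0#≈0#; -‿involutive)
  open import Algebra.Properties.AbelianGroup +-abelianGroup using (⁻¹-∙-comm)
  open import Algebra.Properties.CommutativeSemigroup +-commutativeSemigroup
    using () renaming (interchange to +-interchange)
  open import Algebra.Properties.CommutativeSemigroup *-commutativeSemigroup
    using () renaming (interchange to *-interchange)
  open import Algebra.Properties.Semiring.Mult.TCOptimised semiring
    using (×-homo-+; ×1-homo-*; 1+×) renaming (_×_ to _×′_)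
  open import Relation.Binary.Reasoning.Setoid setoid

  fromℤ : ℤ → Carrier
  fromℤ (+ n)    = n ×′ 1#
  fromℤ -[1+ n ] = - (suc n ×′ 1#)

  [a+x]-[a+y]≈x-y : ∀ a x y → (a + x) - (a + y) ≈ x - y
  [a+x]-[a+y]≈x-y a x y = begin
    (a + x) - (a + y)       ≈⟨ +-congˡ (⁻¹-∙-comm a y) ⟨
    (a + x) + (- a + - y)   ≈⟨ +-interchange a x (- a) (- y) ⟩
    (a - a) + (x - y)       ≈⟨ +-congʳ (-‿inverseʳ a) ⟩
    0# + (x - y)            ≈⟨ +-identityˡ (x - y) ⟩
    x - y                   ∎

  fromℤ-⊖ : ∀ m n → fromℤ (m ⊖ n) ≈ m ×′ 1# - n ×′ 1#
  fromℤ-⊖ m zero = begin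
    fromℤ (m ⊖ 0)    ≡⟨ ≡.cong fromℤ (ℤ.⊖-≥ {m} ℕ.z≤n) ⟩
    m ×′ 1#          ≈⟨ +-identityʳ (m ×′ 1#) ⟨
    m ×′ 1# + 0#     ≈⟨ +-congˡ -0#≈0# ⟨
    m ×′ 1# - 0#     ∎
  fromℤ-⊖ zero (suc n) = sym (+-identityˡ _)
  fromℤ-⊖ (suc m) (suc n) = begin
    fromℤ (suc m ⊖ suc n)               ≡⟨ ≡.cong fromℤ (ℤ.[1+m]⊖[1+n]≡m⊖n m n) ⟩
    fromℤ (m ⊖ n)                       ≈⟨ fromℤ-⊖ m n ⟩
    m ×′ 1# - n ×′ 1#                   ≈⟨ [a+x]-[a+y]≈x-y 1# (m ×′ 1#) (n ×′ 1#) ⟨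
    (1# + m ×′ 1#) - (1# + n ×′ 1#)     ≈⟨ +-cong (1+× m 1#) (-‿cong (1+× n 1#)) ⟨
    suc m ×′ 1# - suc n ×′ 1#           ∎

  fromℤ-homo-+ : ∀ i j → fromℤ (i ℤ.+ j) ≈ fromℤ i + fromℤ j
  fromℤ-homo-+ (+ m)    (+ n)    = ×-homo-+ 1# m n
  fromℤ-homo-+ (+ m)    -[1+ n ] = fromℤ-⊖ m (suc n)
  fromℤ-homo-+ -[1+ m ] (+ n)    = trans (fromℤ-⊖ n (suc m)) (+-comm _ _)
  fromℤ-homo-+ -[1+ m ] -[1+ n ] = begin
    - (suc (suc (m ℕ.+ n)) ×′ 1#)       ≡⟨ ≡.cong (λ k → - (suc k ×′ 1#)) (ℕ.+-suc m n) ⟨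
    - ((suc m ℕ.+ suc n) ×′ 1#)         ≈⟨ -‿cong (×-homo-+ 1# (suc m) (suc n)) ⟩
    - (suc m ×′ 1# + suc n ×′ 1#)       ≈⟨ ⁻¹-∙-comm _ _ ⟨
    - (suc m ×′ 1#) + - (suc n ×′ 1#)   ∎

  signed : Sign → Carrier
  signed Sign.+ = 1#
  signed Sign.- = - 1#

  signed-homo-* : ∀ s t → signed (s Sign.* t) ≈ signed s * signed t
  signed-homo-* Sign.+ t      = sym (*-identityˡ _)
  signed-homo-* Sign.- Sign.+ = sym (*-identityʳ _)
  signed-homo-* Sign.- Sign.- = sym (trans (-1*x≈-x _) (-‿involutive _))

  fromℤ-◃ : ∀ s n → fromℤ (s ℤ.◃ n) ≈ signed s * (n ×′ 1#)
  fromℤ-◃ s      zero    = sym (zeroʳ _)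
  fromℤ-◃ Sign.+ (suc n) = sym (*-identityˡ _)
  fromℤ-◃ Sign.- (suc n) = sym (-1*x≈-x _)

  fromℤ-sign-abs : ∀ i → fromℤ i ≈ signed (ℤ.sign i) * (ℤ.∣ i ∣ ×′ 1#)
  fromℤ-sign-abs i = trans (reflexive (≡.cong fromℤ (≡.sym (ℤ.◃-inverse i)))) (fromℤ-◃ (ℤ.sign i) ℤ.∣ i ∣)

  fromℤ-homo-* : ∀ i j → fromℤ (i ℤ.* j) ≈ fromℤ i * fromℤ j
  fromℤ-homo-* i j = begin
    fromℤ (i ℤ.* j)
      ≈⟨ fromℤ-◃ (ℤ.sign i Sign.* ℤ.sign j) (ℤ.∣ i ∣ ℕ.* ℤ.∣ j ∣) ⟩
    signed (ℤ.sign i Sign.* ℤ.sign j) * ((ℤ.∣ i ∣ ℕ.* ℤ.∣ j ∣) ×′ 1#)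
      ≈⟨ *-cong (signed-homo-* (ℤ.sign i) (ℤ.sign j)) (×1-homo-* ℤ.∣ i ∣ ℤ.∣ j ∣) ⟩
    (sign i * sign j) * (abs i * abs j)
      ≈⟨ *-interchange (sign i) (sign j) (abs i) (abs j) ⟩
    (sign i * abs i) * (sign j * abs j)
      ≈⟨ *-cong (fromℤ-sign-abs i) (fromℤ-sign-abs j) ⟨
    fromℤ i * fromℤ j
      ∎
    where
    sign abs : ℤ → Carrier
    sign k = signed (ℤ.sign k)
    abs  k = ℤ.∣ k ∣ ×′ 1#

  fromℤ-homo-- : ∀ i → fromℤ (ℤ.- i) ≈ - fromℤ i
  fromℤ-homo-- (+ zero)  = sym -0#≈0#
  fromℤ-homo-- (+ suc n) = refl
  fromℤ-homo-- -[1+ n ]  = sym (-‿involutive _)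

  fromℤ-homomorphism : ℤ.+-*-rawRing -Raw-AlmostCommutative⟶ fromCommutativeRing R
  fromℤ-homomorphism = record
    { ⟦_⟧    = fromℤ
    ; +-homo = fromℤ-homo-+
    ; *-homo = fromℤ-homo-*
    ; -‿homo = fromℤ-homo--
    ; 0-homo = refl
    ; 1-homo = refl
    }

  fromℤ-≟ : ∀ i j → Maybe (fromℤ i ≈ fromℤ j)
  fromℤ-≟ i j with i ℤ.≟ j
  ... | yes ≡.refl = just refl
  ... | no _       = nothing

  open import Algebra.Solver.Ring ℤ.+-*-rawRing (fromCommutativeRing R) fromℤ-homomorphism fromℤ-≟ public

module Conjugation {g ℓ : Level} (G : Group g ℓ) where
  open Group G
  open import Algebra.Properties.Group G using (quasigroup; \\-leftDividesʳ; //-rightDividesʳ)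
  open import Algebra.Properties.Quasigroup quasigroup using (x≈z//y)
  open import Relation.Binary.Reasoning.Setoid setoid

  -- A record rather than the bare equation, so that x, a and b stay inferable from the type
  -- even when _≈_ does not determine the elements (as for SL₂, whose _≈_ ignores det proofs).
  record Conjugates (x a b : Carrier) : Set ℓ where
    constructor conjugates
    field x∙a≈b∙x : x ∙ a ≈ b ∙ x

  conjugates-⁻¹ : ∀ {x a b} → Conjugates x a b → Conjugates (x ⁻¹) b a
  conjugates-⁻¹ {x} {a} {b} (conjugates xa≈bx) = conjugates $ begin
    x ⁻¹ ∙ b                  ≈⟨ ∙-congˡ (x≈z//y b x (b ∙ x) refl) ⟩
    x ⁻¹ ∙ ((b ∙ x) ∙ x ⁻¹)   ≈⟨ ∙-congˡ (∙-congʳ xa≈bx) ⟨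
    x ⁻¹ ∙ ((x ∙ a) ∙ x ⁻¹)   ≈⟨ assoc (x ⁻¹) (x ∙ a) (x ⁻¹) ⟨
    (x ⁻¹ ∙ (x ∙ a)) ∙ x ⁻¹   ≈⟨ ∙-congʳ (\\-leftDividesʳ x a) ⟩
    a ∙ x ⁻¹                  ∎

  conjugates-∙ : ∀ {x y a b c} → Conjugates x a b → Conjugates y b c → Conjugates (y ∙ x) a c
  conjugates-∙ {x} {y} {a} {b} {c} (conjugates xa≈bx) (conjugates yb≈cy) = conjugates $ begin
    (y ∙ x) ∙ a   ≈⟨ assoc y x a ⟩
    y ∙ (x ∙ a)   ≈⟨ ∙-congˡ xa≈bx ⟩
    y ∙ (b ∙ x)   ≈⟨ assoc y b x ⟨
    (y ∙ b) ∙ x   ≈⟨ ∙-congʳ yb≈cy ⟩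
    (c ∙ y) ∙ x   ≈⟨ assoc c y x ⟩
    c ∙ (y ∙ x)   ∎

  conjugates⇒commutator : ∀ {x u z} → Conjugates x u (z ∙ u) → z ≈ ((x ∙ u) ∙ x ⁻¹) ∙ u ⁻¹
  conjugates⇒commutator {x} {u} {z} (conjugates xu≈zux) = begin
    z                         ≈⟨ //-rightDividesʳ u z ⟨
    (z ∙ u) ∙ u ⁻¹            ≈⟨ ∙-congʳ (x≈z//y (z ∙ u) x (x ∙ u) (sym xu≈zux)) ⟩
    ((x ∙ u) ∙ x ⁻¹) ∙ u ⁻¹   ∎

module Matrices {c ℓ : Level} (R : CommutativeRing c ℓ) where
  open CommutativeRing R
  open IntegerCoefficients R using (solve; _:+_; _:*_; _:-_; :-_; _:=_; con)

  infixl 7 _⊙_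
  infix  4 _≋_

  _⊙_ : M₂ R → M₂ R → M₂ R
  _⊙_ = _·_ R

  _≋_ : M₂ R → M₂ R → Set ℓ
  _≋_ = _≈M_ R

  diag : Carrier → Carrier → M₂ R
  diag μ ν = mat μ 0# 0# ν

  I : M₂ R
  I = diag 1# 1#

  ≋-refl : ∀ {A} → A ≋ A
  ≋-refl = refl , refl , refl , refl

  ≋-sym : ∀ {A B} → A ≋ B → B ≋ A
  ≋-sym (p , q , r , s) = sym p , sym q , sym r , sym s

  ≋-trans : ∀ {A B C} → A ≋ B → B ≋ C → A ≋ C
  ≋-trans (p , q , r , s) (p′ , q′ , r′ , s′) = trans p p′ , trans q q′ , trans r r′ , trans s s′

  ⊙-cong : ∀ {A A′ B B′} → A ≋ A′ → B ≋ B′ → A ⊙ B ≋ A′ ⊙ B′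
  ⊙-cong (a₁ , a₂ , a₃ , a₄) (b₁ , b₂ , b₃ , b₄) =
    +-cong (*-cong a₁ b₁) (*-cong a₂ b₃) , +-cong (*-cong a₁ b₂) (*-cong a₂ b₄) ,
    +-cong (*-cong a₃ b₁) (*-cong a₄ b₃) , +-cong (*-cong a₃ b₂) (*-cong a₄ b₄)

  ⊙-assoc : ∀ A B C → (A ⊙ B) ⊙ C ≋ A ⊙ (B ⊙ C)
  ⊙-assoc (mat a b c d) (mat e f g h) (mat i j k l) =
    row-col a b e f g h i k , row-col a b e f g h j l , row-col c d e f g h i k , row-col c d e f g h j l
    where
    row-col : ∀ x y e f g h z w → (x * e + y * g) * z + (x * f + y * h) * w ≈ x * (e * z + f * w) + y * (g * z + h * w)
    row-col = solve 8 (λ x y e f g h z w →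
      (x :* e :+ y :* g) :* z :+ (x :* f :+ y :* h) :* w := x :* (e :* z :+ f :* w) :+ y :* (g :* z :+ h :* w)) refl

  ⊙-identityˡ : ∀ A → I ⊙ A ≋ A
  ⊙-identityˡ (mat a b c d) = first a c , first b d , second a c , second b d
    where
    first : ∀ x y → 1# * x + 0# * y ≈ x
    first = solve 2 (λ x y → con (+ 1) :* x :+ con (+ 0) :* y := x) refl
    second : ∀ x y → 0# * x + 1# * y ≈ y
    second = solve 2 (λ x y → con (+ 0) :* x :+ con (+ 1) :* y := y) refl

  ⊙-identityʳ : ∀ A → A ⊙ I ≋ A
  ⊙-identityʳ (mat a b c d) = first a b , second a b , first c d , second c d
    where
    first : ∀ x y → x * 1# + y * 0# ≈ x
    first = solve 2 (λ x y → x :* con (+ 1) :+ y :* con (+ 0) := x) refl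
    second : ∀ x y → x * 0# + y * 1# ≈ y
    second = solve 2 (λ x y → x :* con (+ 0) :+ y :* con (+ 1) := y) refl

  ⊙-adj : ∀ A → det R A ≈ 1# → A ⊙ adj R A ≋ I
  ⊙-adj (mat a b c d) det≈1 =
    trans (on-diagonal a b c d) det≈1 , off-diagonal a b , off-diagonal′ c d , trans (on-diagonal′ a b c d) det≈1
    where
    on-diagonal : ∀ a b c d → a * d + b * (- c) ≈ a * d - b * c
    on-diagonal = solve 4 (λ a b c d → a :* d :+ b :* (:- c) := a :* d :- b :* c) refl
    on-diagonal′ : ∀ a b c d → c * (- b) + d * a ≈ a * d - b * c
    on-diagonal′ = solve 4 (λ a b c d → c :* (:- b) :+ d :* a := a :* d :- b :* c) refl
    off-diagonal : ∀ x y → x * (- y) + y * x ≈ 0#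
    off-diagonal = solve 2 (λ x y → x :* (:- y) :+ y :* x := con (+ 0)) refl
    off-diagonal′ : ∀ x y → x * y + y * (- x) ≈ 0#
    off-diagonal′ = solve 2 (λ x y → x :* y :+ y :* (:- x) := con (+ 0)) refl

  adj-⊙ : ∀ A → det R A ≈ 1# → adj R A ⊙ A ≋ I
  adj-⊙ (mat a b c d) det≈1 =
    trans (on-diagonal a b c d) det≈1 , off-diagonal b d , off-diagonal′ a c , trans (on-diagonal′ a b c d) det≈1
    where
    on-diagonal : ∀ a b c d → d * a + (- b) * c ≈ a * d - b * c
    on-diagonal = solve 4 (λ a b c d → d :* a :+ (:- b) :* c := a :* d :- b :* c) refl
    on-diagonal′ : ∀ a b c d → (- c) * b + a * d ≈ a * d - b * c
    on-diagonal′ = solve 4 (λ a b c d → (:- c) :* b :+ a :* d := a :* d :- b :* c) refl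
    off-diagonal : ∀ x y → y * x + (- x) * y ≈ 0#
    off-diagonal = solve 2 (λ x y → y :* x :+ (:- x) :* y := con (+ 0)) refl
    off-diagonal′ : ∀ x y → (- y) * x + x * y ≈ 0#
    off-diagonal′ = solve 2 (λ x y → (:- y) :* x :+ x :* y := con (+ 0)) refl

  adj-cong : ∀ {A B} → A ≋ B → adj R A ≋ adj R B
  adj-cong (p , q , r , s) = s , -‿cong q , -‿cong r , p

  det-⊙ : ∀ A B → det R (A ⊙ B) ≈ det R A * det R B
  det-⊙ (mat a b c d) (mat e f g h) = solve 8 (λ a b c d e f g h →
    (a :* e :+ b :* g) :* (c :* f :+ d :* h) :- (a :* f :+ b :* h) :* (c :* e :+ d :* g)
      := (a :* d :- b :* c) :* (e :* h :- f :* g)) refl a b c d e f g h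

  det-adj : ∀ A → det R (adj R A) ≈ det R A
  det-adj (mat a b c d) = solve 4 (λ a b c d → d :* a :- (:- b) :* (:- c) := a :* d :- b :* c) refl a b c d

  det-diag : ∀ μ ν → det R (diag μ ν) ≈ μ * ν
  det-diag = solve 2 (λ μ ν → μ :* ν :- con (+ 0) :* con (+ 0) := μ :* ν) refl

  det-I : det R I ≈ 1#
  det-I = trans (det-diag 1# 1#) (*-identityˡ 1#)

  SL₂ : Group (c ⊔ ℓ) ℓ
  SL₂ = record
    { Carrier = Σ (M₂ R) (InSL₂ R)
    ; _≈_     = λ X Y → proj₁ X ≋ proj₁ Y
    ; _∙_     = λ (A , detA≈1) (B , detB≈1) →
                  A ⊙ B , trans (det-⊙ A B) (trans (*-cong detA≈1 detB≈1) (*-identityˡ 1#))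
    ; ε       = I , det-I
    ; _⁻¹     = λ (A , detA≈1) → adj R A , trans (det-adj A) detA≈1
    ; isGroup = record
      { isMonoid = record
        { isSemigroup = record
          { isMagma = record
            { isEquivalence = record { refl = ≋-refl ; sym = ≋-sym ; trans = ≋-trans }
            ; ∙-cong        = ⊙-cong
            }
          ; assoc = λ X Y Z → ⊙-assoc (proj₁ X) (proj₁ Y) (proj₁ Z)
          }
        ; identity = (λ X → ⊙-identityˡ (proj₁ X)) , (λ X → ⊙-identityʳ (proj₁ X))
        }
      ; inverse = (λ (A , detA≈1) → adj-⊙ A detA≈1) , (λ (A , detA≈1) → ⊙-adj A detA≈1)
      ; ⁻¹-cong = adj-cong
      }
    }

  _⊗_ : Carrier × Carrier → Carrier × Carrier → M₂ R
  (v₁ , v₂) ⊗ (w₁ , w₂) = mat (v₁ * w₁) (v₁ * w₂) (v₂ * w₁) (v₂ * w₂)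

  _+ᴵ_ : M₂ R → Carrier → M₂ R
  mat a b c d +ᴵ t = mat (a + t) b c (d + t)

  +ᴵ-cong : ∀ {A B} t → A ≋ B → A +ᴵ t ≋ B +ᴵ t
  +ᴵ-cong {mat _ _ _ _} {mat _ _ _ _} t (p , q , r , s) = +-congʳ p , q , r , +-congʳ s

  +ᴵ-inverse : ∀ A t → (A +ᴵ (- t)) +ᴵ t ≋ A
  +ᴵ-inverse (mat a b c d) t = cancel a t , refl , refl , cancel d t
    where
    cancel : ∀ x t → (x + - t) + t ≈ x
    cancel = solve 2 (λ x t → (x :+ :- t) :+ t := x) refl

  det-+ᴵ : ∀ A t → det R (A +ᴵ t) ≈ det R A + t * Tr R A + t * t
  det-+ᴵ (mat a b c d) t = solve 5 (λ a b c d t →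
    (a :+ t) :* (d :+ t) :- b :* c := (a :* d :- b :* c) :+ t :* (a :+ d) :+ t :* t) refl a b c d t

  -- The columns v and k (−w₂, w₁) are eigenvectors of v wᵀ + tI with eigenvalues
  -- w·v + t = Tr (v ⊗ w) + t and t, the latter being orthogonal to w.
  eigenbasis : Carrier → Carrier × Carrier → Carrier × Carrier → M₂ R
  eigenbasis k (v₁ , v₂) (w₁ , w₂) = mat v₁ (- (k * w₂)) v₂ (k * w₁)

  det-eigenbasis : ∀ k v w → det R (eigenbasis k v w) ≈ k * Tr R (v ⊗ w)
  det-eigenbasis k (v₁ , v₂) (w₁ , w₂) = solve 5 (λ k v₁ v₂ w₁ w₂ →
    v₁ :* (k :* w₁) :- (:- (k :* w₂)) :* v₂ := k :* (v₁ :* w₁ :+ v₂ :* w₂)) refl k v₁ v₂ w₁ w₂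

  outer+ᴵ-eigenbasis : ∀ t k v w →
    ((v ⊗ w) +ᴵ t) ⊙ eigenbasis k v w ≋ eigenbasis k v w ⊙ diag (Tr R (v ⊗ w) + t) t
  outer+ᴵ-eigenbasis t k (v₁ , v₂) (w₁ , w₂) =
    solve 6 (λ v₁ v₂ w₁ w₂ t k → (v₁ :* w₁ :+ t) :* v₁ :+ v₁ :* w₂ :* v₂
      := v₁ :* ((v₁ :* w₁ :+ v₂ :* w₂) :+ t) :+ (:- (k :* w₂)) :* con (+ 0)) refl v₁ v₂ w₁ w₂ t k ,
    solve 6 (λ v₁ v₂ w₁ w₂ t k → (v₁ :* w₁ :+ t) :* (:- (k :* w₂)) :+ v₁ :* w₂ :* (k :* w₁)
      := v₁ :* con (+ 0) :+ (:- (k :* w₂)) :* t) refl v₁ v₂ w₁ w₂ t k ,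
    solve 6 (λ v₁ v₂ w₁ w₂ t k → v₂ :* w₁ :* v₁ :+ (v₂ :* w₂ :+ t) :* v₂
      := v₂ :* ((v₁ :* w₁ :+ v₂ :* w₂) :+ t) :+ (k :* w₁) :* con (+ 0)) refl v₁ v₂ w₁ w₂ t k ,
    solve 6 (λ v₁ v₂ w₁ w₂ t k → v₂ :* w₁ :* (:- (k :* w₂)) :+ (v₂ :* w₂ :+ t) :* (k :* w₁)
      := v₂ :* con (+ 0) :+ (k :* w₁) :* t) refl v₁ v₂ w₁ w₂ t k

module PrincipalIdealDomain {c ℓ : Level} (R : CommutativeRing c ℓ) (pid : IsPID R) where
  open CommutativeRing R
  open IntegerCoefficients R using (solve; _:+_; _:*_; :-_; _:=_; con)
  open Matrices R using (_≋_; _⊗_)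
  open import Algebra.Properties.Ring ring using (x[y-z]≈xy-xz)
  open import Algebra.Properties.Group +-group
    using () renaming (x∙y⁻¹≈ε⇒x≈y to x-y≈0⇒x≈y; x≈y⇒x∙y⁻¹≈ε to x≈y⇒x-y≈0)
  open import Relation.Binary.Reasoning.Setoid setoid

  x*y≈x*z⇒x≈0⊎y≈z : ∀ x y z → x * y ≈ x * z → x ≈ 0# ⊎ y ≈ z
  x*y≈x*z⇒x≈0⊎y≈z x y z xy≈xz = map₂ (x-y≈0⇒x≈y y z)
    (proj₂ (proj₁ pid) x (y - z) (trans (x[y-z]≈xy-xz x y z) (x≈y⇒x-y≈0 xy≈xz)))

  Combination : Carrier → Carrier → Carrier → Set (c ⊔ ℓ)
  Combination a b x = Σ Carrier λ r → Σ Carrier λ s → x ≈ r * a + s * b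

  Combination-isIdeal : ∀ a b → IsIdeal R (Combination a b)
  Combination-isIdeal a b = record
    { resp  = λ { x≈y (r , s , x≈ra+sb) → r , s , trans (sym x≈y) x≈ra+sb }
    ; zero∈ = 0# , 0# , solve 2 (λ a b → con (+ 0) := con (+ 0) :* a :+ con (+ 0) :* b) refl a b
    ; +∈    = λ { (r , s , x≈) (r′ , s′ , y≈) → r + r′ , s + s′ , trans (+-cong x≈ y≈)
                (solve 6 (λ r s r′ s′ a b → (r :* a :+ s :* b) :+ (r′ :* a :+ s′ :* b)
                                              := (r :+ r′) :* a :+ (s :+ s′) :* b) refl r s r′ s′ a b) }
    ; -∈    = λ { (r , s , x≈) → - r , - s , trans (-‿cong x≈)
                (solve 4 (λ r s a b → :- (r :* a :+ s :* b) := (:- r) :* a :+ (:- s) :* b) refl r s a b) }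
    ; *∈    = λ t → λ { (r , s , x≈) → t * r , t * s , trans (*-congˡ x≈)
                (solve 5 (λ t r s a b → t :* (r :* a :+ s :* b) := (t :* r) :* a :+ (t :* s) :* b) refl t r s a b) }
    }

  record Bezout (a b : Carrier) : Set (c ⊔ ℓ) where
    field
      gcd α β r s : Carrier
      a≈α*gcd     : a ≈ α * gcd
      b≈β*gcd     : b ≈ β * gcd
      gcd≈ra+sb   : gcd ≈ r * a + s * b

  bezout : ∀ a b → Bezout a b
  bezout a b =
    let (g , generates)   = proj₂ pid (Combination a b) (Combination-isIdeal a b)
        (α , a≈αg)        = proj₁ (generates a) (1# , 0# , a≈1a+0b)
        (β , b≈βg)        = proj₁ (generates b) (0# , 1# , b≈0a+1b)
        (r , s , g≈ra+sb) = proj₂ (generates g) (1# , sym (*-identityˡ g))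
    in record { a≈α*gcd = a≈αg ; b≈β*gcd = b≈βg ; gcd≈ra+sb = g≈ra+sb }
    where
    a≈1a+0b : a ≈ 1# * a + 0# * b
    a≈1a+0b = solve 2 (λ a b → a := con (+ 1) :* a :+ con (+ 0) :* b) refl a b

    b≈0a+1b : b ≈ 0# * a + 1# * b
    b≈0a+1b = solve 2 (λ a b → b := con (+ 0) :* a :+ con (+ 1) :* b) refl a b

  IsOuterProduct : M₂ R → Set (c ⊔ ℓ)
  IsOuterProduct A = Σ (Carrier × Carrier) λ v → Σ (Carrier × Carrier) λ w → A ≋ v ⊗ w

  module _ {a b c d : Carrier} (ad≈bc : a * d ≈ b * c) (B : Bezout a c) where
    open Bezout B

    gcd*αd≈gcd*βb : gcd * (α * d) ≈ gcd * (β * b)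
    gcd*αd≈gcd*βb = begin
      gcd * (α * d)   ≈⟨ solve 3 (λ g α d → g :* (α :* d) := (α :* g) :* d) refl gcd α d ⟩
      (α * gcd) * d   ≈⟨ *-congʳ a≈α*gcd ⟨
      a * d           ≈⟨ ad≈bc ⟩
      b * c           ≈⟨ *-congˡ b≈β*gcd ⟩
      b * (β * gcd)   ≈⟨ solve 3 (λ g β b → b :* (β :* g) := g :* (β :* b)) refl gcd β b ⟩
      gcd * (β * b)   ∎

    gcd*[rα+sβ]≈gcd*1 : gcd * (r * α + s * β) ≈ gcd * 1#
    gcd*[rα+sβ]≈gcd*1 = begin
      gcd * (r * α + s * β)           ≈⟨ solve 5 (λ g r α s β → g :* (r :* α :+ s :* β) := r :* (α :* g) :+ s :* (β :* g)) refl gcd r α s β ⟩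
      r * (α * gcd) + s * (β * gcd)   ≈⟨ +-cong (*-congˡ a≈α*gcd) (*-congˡ b≈β*gcd) ⟨
      r * a + s * c                   ≈⟨ gcd≈ra+sb ⟨
      gcd                             ≈⟨ *-identityʳ gcd ⟨
      gcd * 1#                        ∎

    outer-of-gcd≈0 : gcd ≈ 0# → IsOuterProduct (mat a b c d)
    outer-of-gcd≈0 gcd≈0 = (b , d) , (0# , 1#) ,
      vanishes a≈α*gcd b , sym (*-identityʳ b) , vanishes b≈β*gcd d , sym (*-identityʳ d)
      where
      vanishes : ∀ {x q} → x ≈ q * gcd → ∀ y → x ≈ y * 0#
      vanishes {x} {q} x≈q*gcd y = begin
        x         ≈⟨ x≈q*gcd ⟩
        q * gcd   ≈⟨ *-congˡ gcd≈0 ⟩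
        q * 0#    ≈⟨ zeroʳ q ⟩
        0#        ≈⟨ zeroʳ y ⟨
        y * 0#    ∎

    outer-of-coprime : α * d ≈ β * b → r * α + s * β ≈ 1# → IsOuterProduct (mat a b c d)
    outer-of-coprime αd≈βb rα+sβ≈1 =
      (α , β) , (gcd , r * b + s * d) , a≈α*gcd , b≈α[rb+sd] , b≈β*gcd , d≈β[rb+sd]
      where
      b≈α[rb+sd] : b ≈ α * (r * b + s * d)
      b≈α[rb+sd] = begin
        b                         ≈⟨ *-identityʳ b ⟨
        b * 1#                    ≈⟨ *-congˡ rα+sβ≈1 ⟨
        b * (r * α + s * β)       ≈⟨ solve 5 (λ b r α s β → b :* (r :* α :+ s :* β) := r :* α :* b :+ s :* (β :* b)) refl b r α s β ⟩
        r * α * b + s * (β * b)   ≈⟨ +-congˡ (*-congˡ αd≈βb) ⟨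
        r * α * b + s * (α * d)   ≈⟨ solve 5 (λ b d r α s → r :* α :* b :+ s :* (α :* d) := α :* (r :* b :+ s :* d)) refl b d r α s ⟩
        α * (r * b + s * d)       ∎

      d≈β[rb+sd] : d ≈ β * (r * b + s * d)
      d≈β[rb+sd] = begin
        d                         ≈⟨ *-identityʳ d ⟨
        d * 1#                    ≈⟨ *-congˡ rα+sβ≈1 ⟨
        d * (r * α + s * β)       ≈⟨ solve 5 (λ d r α s β → d :* (r :* α :+ s :* β) := r :* (α :* d) :+ s :* β :* d) refl d r α s β ⟩
        r * (α * d) + s * β * d   ≈⟨ +-congʳ (*-congˡ αd≈βb) ⟩
        r * (β * b) + s * β * d   ≈⟨ solve 5 (λ b d r s β → r :* (β :* b) :+ s :* β :* d := β :* (r :* b :+ s :* d)) refl b d r s β ⟩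
        β * (r * b + s * d)       ∎

    outer-of-bezout : IsOuterProduct (mat a b c d)
    outer-of-bezout with x*y≈x*z⇒x≈0⊎y≈z gcd _ _ gcd*αd≈gcd*βb | x*y≈x*z⇒x≈0⊎y≈z gcd _ _ gcd*[rα+sβ]≈gcd*1
    ... | inj₂ αd≈βb | inj₂ rα+sβ≈1 = outer-of-coprime αd≈βb rα+sβ≈1
    ... | inj₁ gcd≈0 | _            = outer-of-gcd≈0 gcd≈0
    ... | _          | inj₁ gcd≈0   = outer-of-gcd≈0 gcd≈0

  det≈0⇒outer : ∀ A → det R A ≈ 0# → IsOuterProduct A
  det≈0⇒outer (mat a b c d) det≈0 = outer-of-bezout (x-y≈0⇒x≈y (a * d) (b * c) det≈0) (bezout a c)

module Diagonalisation {c ℓ : Level} (R : CommutativeRing c ℓ) (pid : IsPID R)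
  (ε ε⁻¹ : CommutativeRing.Carrier R) (εε⁻¹≈1 : IsInverse R ε ε⁻¹)
  (η⁻¹ : CommutativeRing.Carrier R) (ηη⁻¹≈1 : IsInverse R (CommutativeRing._-_ R ε ε⁻¹) η⁻¹) where
  open CommutativeRing R
  open IntegerCoefficients R using (solve; _:+_; _:*_; _:-_; :-_; _:=_; con)
  open Matrices R
  open Conjugation SL₂ using (Conjugates; conjugates)
  open PrincipalIdealDomain R pid using (det≈0⇒outer)
  open import Relation.Binary.Reasoning.Setoid setoid

  det[A-ε⁻¹I]≈0 : ∀ A → det R A ≈ 1# → Tr R A ≈ ε + ε⁻¹ → det R (A +ᴵ (- ε⁻¹)) ≈ 0#
  det[A-ε⁻¹I]≈0 A detA≈1 trA≈ε+ε⁻¹ = begin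
    det R (A +ᴵ (- ε⁻¹))                             ≈⟨ det-+ᴵ A (- ε⁻¹) ⟩
    det R A + (- ε⁻¹) * Tr R A + (- ε⁻¹) * (- ε⁻¹)   ≈⟨ +-congʳ (+-cong detA≈1 (*-congˡ trA≈ε+ε⁻¹)) ⟩
    1# + (- ε⁻¹) * (ε + ε⁻¹) + (- ε⁻¹) * (- ε⁻¹)     ≈⟨ solve 2 (λ ε t → con (+ 1) :+ (:- t) :* (ε :+ t) :+ (:- t) :* (:- t)
                                                           := con (+ 1) :- ε :* t) refl ε ε⁻¹ ⟩
    1# - ε * ε⁻¹                                     ≈⟨ +-congˡ (-‿cong εε⁻¹≈1) ⟩
    1# - 1#                                          ≈⟨ -‿inverseʳ 1# ⟩
    0#                                               ∎

  module _ {a b c d : Carrier} {v w : Carrier × Carrier}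
           (A-ε⁻¹I≋v⊗w : mat a b c d +ᴵ (- ε⁻¹) ≋ v ⊗ w) (trA≈ε+ε⁻¹ : a + d ≈ ε + ε⁻¹) where

    tr[v⊗w]≈ε-ε⁻¹ : Tr R (v ⊗ w) ≈ ε - ε⁻¹
    tr[v⊗w]≈ε-ε⁻¹ = begin
      Tr R (v ⊗ w)            ≈⟨ +-cong (proj₁ A-ε⁻¹I≋v⊗w) (proj₂ (proj₂ (proj₂ A-ε⁻¹I≋v⊗w))) ⟨
      (a - ε⁻¹) + (d - ε⁻¹)   ≈⟨ solve 3 (λ a d t → (a :- t) :+ (d :- t) := (a :+ d) :- t :- t) refl a d ε⁻¹ ⟩
      (a + d) - ε⁻¹ - ε⁻¹     ≈⟨ +-congʳ (+-congʳ trA≈ε+ε⁻¹) ⟩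
      (ε + ε⁻¹) - ε⁻¹ - ε⁻¹   ≈⟨ solve 2 (λ ε t → (ε :+ t) :- t :- t := ε :- t) refl ε ε⁻¹ ⟩
      ε - ε⁻¹                 ∎

    det-eigenbasis≈1 : det R (eigenbasis η⁻¹ v w) ≈ 1#
    det-eigenbasis≈1 = begin
      det R (eigenbasis η⁻¹ v w)   ≈⟨ det-eigenbasis η⁻¹ v w ⟩
      η⁻¹ * Tr R (v ⊗ w)           ≈⟨ *-congˡ tr[v⊗w]≈ε-ε⁻¹ ⟩
      η⁻¹ * (ε - ε⁻¹)              ≈⟨ *-comm η⁻¹ (ε - ε⁻¹) ⟩
      (ε - ε⁻¹) * η⁻¹              ≈⟨ ηη⁻¹≈1 ⟩
      1#                           ∎

    eigenbasis-diagonalises : eigenbasis η⁻¹ v w ⊙ diag ε ε⁻¹ ≋ mat a b c d ⊙ eigenbasis η⁻¹ v w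
    eigenbasis-diagonalises = ≋-sym $ ≋-trans (⊙-cong A≋v⊗w+ε⁻¹I ≋-refl) $
      ≋-trans (outer+ᴵ-eigenbasis ε⁻¹ η⁻¹ v w) (⊙-cong ≋-refl (tr[v⊗w]+ε⁻¹≈ε , refl , refl , refl))
      where
      A≋v⊗w+ε⁻¹I : mat a b c d ≋ (v ⊗ w) +ᴵ ε⁻¹
      A≋v⊗w+ε⁻¹I = ≋-trans (≋-sym (+ᴵ-inverse (mat a b c d) ε⁻¹)) (+ᴵ-cong ε⁻¹ A-ε⁻¹I≋v⊗w)

      tr[v⊗w]+ε⁻¹≈ε : Tr R (v ⊗ w) + ε⁻¹ ≈ ε
      tr[v⊗w]+ε⁻¹≈ε = trans (+-congʳ tr[v⊗w]≈ε-ε⁻¹) (solve 2 (λ ε t → (ε :- t) :+ t := ε) refl ε ε⁻¹)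

  diagonal : Group.Carrier SL₂
  diagonal = diag ε ε⁻¹ , trans (det-diag ε ε⁻¹) εε⁻¹≈1

  diagonalise : ∀ a → Tr R (proj₁ a) ≈ ε + ε⁻¹ → Σ (Group.Carrier SL₂) λ s → Conjugates s diagonal a
  diagonalise (A@(mat _ _ _ _) , detA≈1) trA≈ε+ε⁻¹ =
    let (v , w , A-ε⁻¹I≋v⊗w) = det≈0⇒outer (A +ᴵ (- ε⁻¹)) (det[A-ε⁻¹I]≈0 A detA≈1 trA≈ε+ε⁻¹)
    in (eigenbasis η⁻¹ v w , det-eigenbasis≈1 A-ε⁻¹I≋v⊗w trA≈ε+ε⁻¹) ,
       conjugates (eigenbasis-diagonalises A-ε⁻¹I≋v⊗w trA≈ε+ε⁻¹)

proposition4p6 : ∀ {c ℓ : Level} (D : CommutativeRing c ℓ) → IsPID D →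
    (ε ε⁻¹ : CommutativeRing.Carrier D) → IsInverse D ε ε⁻¹ →
    Σ (CommutativeRing.Carrier D) (λ η⁻¹ → IsInverse D (CommutativeRing._-_ D ε ε⁻¹) η⁻¹) →
    (Z : M₂ D) → InSL₂ D Z →
    Σ (M₂ D) (λ U → 𝔖 D Z U × CommutativeRing._≈_ D (Tr D U) (CommutativeRing._+_ D ε ε⁻¹)) →
    IsCommutatorSL₂ D Z
proposition4p6 D pid ε ε⁻¹ εε⁻¹≈1 (η⁻¹ , ηη⁻¹≈1) Z detZ≈1 (U , (trZU≈trU , detU≈1) , trU≈ε+ε⁻¹) =
  proj₁ x , U , proj₂ x , detU≈1 , z≈[x,u]
  where
  open Matrices D using (SL₂)
  open Group SL₂ using (Carrier; _≈_; _∙_; _⁻¹)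
  open Conjugation SL₂
  open Diagonalisation D pid ε ε⁻¹ εε⁻¹≈1 η⁻¹ ηη⁻¹≈1

  z u : Carrier
  z = Z , detZ≈1
  u = U , detU≈1

  sᵤ : Σ Carrier λ s → Conjugates s diagonal u
  sᵤ = diagonalise u trU≈ε+ε⁻¹

  sᵥ : Σ Carrier λ s → Conjugates s diagonal (z ∙ u)
  sᵥ = diagonalise (z ∙ u) (CommutativeRing.trans D trZU≈trU trU≈ε+ε⁻¹)

  x : Carrier
  x = proj₁ sᵥ ∙ proj₁ sᵤ ⁻¹

  z≈[x,u] : z ≈ ((x ∙ u) ∙ x ⁻¹) ∙ u ⁻¹
  z≈[x,u] = conjugates⇒commutator (conjugates-∙ (conjugates-⁻¹ (proj₂ sᵤ)) (proj₂ sᵥ))
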